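{- Let $F$ be a forest containing a vertex $u$ that is adjacent to at least $5$ leaves $l_1,\dots,l_5$, and let $v$ be a vertex of $F$ different from $u$ and from $l_1,\dots,l_5$. Let $F'$ be obtained from $F$ by deleting the edges $ul_1,ul_2,ul_3$ and adding the edges $vl_1,vl_2,vl_3$. If a coloring $\chi:E(K_m)\to\mathbb{Z}_3$ contains a copy of $F$ whose edge colors sum to $0$, then it also contains a copy of $F'$ whose edge colors sum to $0$.
   Context: A copy of a graph in $K_m$ is a subgraph isomorphic to it; sums are taken in $\mathbb{Z}_3$. -}

module Defs where

open import Data.Bool using (Bool; true; false; if_then_else_; _∧_; _∨_; T)
open import Data.Nat using (ℕ; _≤_; _<ᵇ_; _%_)
open import Data.Fin using (Fin; toℕ; _≟_)
open import Data.List using (allFin; List; []; _∷_; _++_; [_]; length; filter; map; concatMap)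
open import Data.Nat.ListAction using (sum)
open import Data.List.Relation.Unary.Unique.Propositional using (Unique)
open import Data.List.Relation.Unary.Linked using (Linked)
open import Data.Product using (Σ; _×_; ∃)
open import Function.Definitions using (Injective)
open import Relation.Binary.PropositionalEquality using (_≡_)
open import Relation.Nullary using (¬_)
open import Relation.Nullary.Decidable using (⌊_⌋)

record Graph (n : ℕ) : Set where
  field
    Adj   : Fin n → Fin n → Bool
    sym   : ∀ x y → Adj x y ≡ Adj y x
    loopless : ∀ x → Adj x x ≡ false
open Graph public

IsCycle : {n : ℕ} → Graph n → List (Fin n) → Set
IsCycle G [] = T false
IsCycle G (x ∷ xs) =
  (3 ≤ length (x ∷ xs)) × Unique (x ∷ xs) ×
  Linked (λ a b → T (Adj G a b)) ((x ∷ xs) ++ [ x ])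

IsForest : {n : ℕ} → Graph n → Set
IsForest G = ∀ cs → ¬ IsCycle G cs

degree : {n : ℕ} → Graph n → Fin n → ℕ
degree {n} G x = length (filter (λ y → T? (Adj G x y)) (allFin n))
  where
  open import Data.Bool.Properties using () renaming (T? to T?)

IsLeaf : {n : ℕ} → Graph n → Fin n → Set
IsLeaf G x = degree G x ≡ 1

samePair : {n : ℕ} → Fin n → Fin n → Fin n → Fin n → Bool
samePair a b x y = (⌊ a ≟ x ⌋ ∧ ⌊ b ≟ y ⌋) ∨ (⌊ a ≟ y ⌋ ∧ ⌊ b ≟ x ⌋)

moveAdj : {n : ℕ} → Graph n → (u v l₁ l₂ l₃ : Fin n) → Fin n → Fin n → Bool
moveAdj G u v l₁ l₂ l₃ x y =
  if samePair u l₁ x y ∨ samePair u l₂ x y ∨ samePair u l₃ x y then false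
  else if samePair v l₁ x y ∨ samePair v l₂ x y ∨ samePair v l₃ x y then true
  else Adj G x y

-- Colorings of E(K_m) with colors in ℤ₃ = Fin 3: symmetric functions on pairs
-- (values on the diagonal are irrelevant).
Coloring : ℕ → Set
Coloring m = Fin m → Fin m → Fin 3

SymColoring : {m : ℕ} → Coloring m → Set
SymColoring χ = ∀ a b → χ a b ≡ χ b a

copyColorSum : {n m : ℕ} → (Fin n → Fin n → Bool) → Coloring m → (Fin n → Fin m) → ℕ
copyColorSum {n} A χ φ =
  sum (concatMap (λ i → map (λ j → if A i j ∧ (toℕ i <ᵇ toℕ j) then toℕ (χ (φ i) (φ j)) else 0)
                             (allFin n))
                 (allFin n))

HasZeroSumCopy : {n m : ℕ} → (Fin n → Fin n → Bool) → Coloring m → Set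
HasZeroSumCopy {n} {m} A χ =
  Σ (Fin n → Fin m) λ φ → Injective _≡_ _≡_ φ × (copyColorSum A χ φ % 3 ≡ 0)

{-# OPTIONS --safe #-}
module Submission where

-- Let φ be a zero-sum copy of F, and let aₖ and bₖ be the colours of the pairs φ(u)φ(lₖ) and
-- φ(v)φ(lₖ). By the Erdős–Ginzburg–Ziv theorem for ℤ₃, three of the five differences bₖ − aₖ
-- sum to 0. Permute the leaves of the copy so that these three become the images of l₁, l₂, l₃.
-- Off the leaves the new embedding ψ agrees with φ, and ψ(F′) is φ(F) with the three edges
-- φ(u)φ(lₖ) replaced by φ(v)φ(lₖ). Its colour sum therefore differs from that of φ(F) by the
-- sum of those three differences, which is 0.

open import Defs renaming (sym to Adj-sym)
open import Data.Bool using (Bool; true; false; if_then_else_; _∧_; _∨_)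
open import Data.Bool.Properties using (∧-comm; ∨-comm; ∧-zeroʳ)
open import Data.Empty using (⊥-elim)
open import Data.Fin using (Fin; zero; suc; toℕ; _≟_)
open import Data.Fin.Patterns using (0F; 1F; 2F; 3F; 4F)
open import Data.Fin.Permutation using (Permutation′; _⟨$⟩ʳ_; transpose; _∘ₚ_)
open import Data.Fin.Properties using (toℕ-injective; toℕ-fromℕ<; any?; all?)
open import Data.List using (List; map; concatMap; tabulate; allFin; filter; length)
import Data.List as List
open import Data.List.Properties using (map-tabulate)
open import Data.Nat using (ℕ; zero; suc; _+_; _*_; _%_; _<ᵇ_; _≤_; z≤n)
import Data.Nat as ℕ
open import Data.Nat.DivMod using (_mod_; m%n<n; %-distribˡ-+; [m+kn]%n≡m%n; m%n%n≡m%n)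
open import Data.Nat.ListAction using () renaming (sum to listSum)
open import Data.Nat.ListAction.Properties using (sum-++)
open import Data.Nat.Properties
  using (+-0-commutativeMonoid; +-identityʳ; +-comm; +-mono-≤; +-cancelʳ-≡; ≤-reflexive; ≤-antisym;
         1+n≰n; <-asym; ≮⇒≥; <ᵇ-reflects-<; module ≤-Reasoning)
open import Algebra.Properties.CommutativeMonoid.Sum +-0-commutativeMonoid
  using (sum; sum-syntax; sum-cong-≗; ∑-distrib-+; ∑-comm; ∑-permute; sum-replicate-zero)
open import Data.Nat.Tactic.RingSolver using (solve-∀)
open import Data.Product using (∃-syntax; _,_; _×_; proj₁; proj₂)
open import Data.Vec.Functional using (_∷_; [])
open import Function using (_∘_)
open import Function.Bundles using (Injection)
open import Function.Definitions using (Injective)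
open import Function.Properties.Inverse using (↔⇒↣)
open import Relation.Binary.PropositionalEquality
  using (_≡_; _≢_; refl; sym; trans; subst; cong; cong₂; module ≡-Reasoning)
open import Relation.Nullary using (¬_; yes; no)
open import Relation.Nullary.Decidable using (⌊_⌋; ⌊⌋-map′; from-yes)
open import Relation.Nullary.Decidable.Core using (T?)
open import Relation.Nullary.Reflects using (ofʸ; ofⁿ)

private
  variable
    n s : ℕ

-- Iverson brackets and finite sums

infixr 11 [_]·_

[_]·_ : Bool → ℕ → ℕ
[ b ]· k = if b then k else 0

[]·-+ : ∀ b j k → [ b ]· (j + k) ≡ [ b ]· j + [ b ]· k
[]·-+ true  j k = refl
[]·-+ false j k = refl

[]·-∧ : ∀ a b k → [ a ∧ b ]· k ≡ [ a ]· [ b ]· k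
[]·-∧ true  b k = refl
[]·-∧ false b k = refl

[]·-comm : ∀ a b k → [ a ]· [ b ]· k ≡ [ b ]· [ a ]· k
[]·-comm a b k = trans (sym ([]·-∧ a b k)) (trans (cong ([_]· k) (∧-comm a b)) ([]·-∧ b a k))

[]·-∨ : ∀ a b k → a ∧ b ≡ false → [ a ∨ b ]· k ≡ [ a ]· k + [ b ]· k
[]·-∨ true  false k _ = sym (+-identityʳ k)
[]·-∨ false b     k _ = refl

[]·-∑ : ∀ b (f : Fin n → ℕ) → [ b ]· sum f ≡ ∑[ i < n ] [ b ]· f i
[]·-∑     true  f = refl
[]·-∑ {n} false f = sym (sum-replicate-zero n)

∑-point : (a : Fin n) (f : Fin n → ℕ) → ∑[ x < n ] [ ⌊ a ≟ x ⌋ ]· f x ≡ f a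
∑-point {suc n} zero    f = trans (cong (f zero +_) (sum-replicate-zero n)) (+-identityʳ (f zero))
∑-point {suc n} (suc a) f =
  trans (sum-cong-≗ λ x → cong ([_]· f (suc x)) (⌊⌋-map′ _ _ (a ≟ x))) (∑-point a (f ∘ suc))

∑-point-∧ : (i : Fin s) (b : Fin s → Bool) (z : ℕ) → ∑[ k < s ] [ ⌊ i ≟ k ⌋ ∧ b k ]· z ≡ [ b i ]· z
∑-point-∧ i b z = trans (sum-cong-≗ λ k → []·-∧ ⌊ i ≟ k ⌋ (b k) z) (∑-point i (λ k → [ b k ]· z))

∑∑-point : (a b : Fin n) (f : Fin n → Fin n → ℕ) →
           ∑[ x < n ] ∑[ y < n ] [ ⌊ a ≟ x ⌋ ∧ ⌊ b ≟ y ⌋ ]· f x y ≡ f a b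
∑∑-point {n} a b f = begin
  ∑[ x < n ] ∑[ y < n ] [ ⌊ a ≟ x ⌋ ∧ ⌊ b ≟ y ⌋ ]· f x y
    ≡⟨ sum-cong-≗ (λ x → trans (sum-cong-≗ λ y → []·-∧ ⌊ a ≟ x ⌋ ⌊ b ≟ y ⌋ (f x y))
                               (sym ([]·-∑ ⌊ a ≟ x ⌋ (λ y → [ ⌊ b ≟ y ⌋ ]· f x y)))) ⟩
  ∑[ x < n ] [ ⌊ a ≟ x ⌋ ]· (∑[ y < n ] [ ⌊ b ≟ y ⌋ ]· f x y)
    ≡⟨ ∑-point a (λ x → ∑[ y < n ] [ ⌊ b ≟ y ⌋ ]· f x y) ⟩
  ∑[ y < n ] [ ⌊ b ≟ y ⌋ ]· f a y
    ≡⟨ ∑-point b (f a) ⟩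
  f a b ∎
  where open ≡-Reasoning

∑-mono-≤ : {f g : Fin n → ℕ} → (∀ i → f i ≤ g i) → sum f ≤ sum g
∑-mono-≤ {zero}  f≤g = z≤n
∑-mono-≤ {suc n} f≤g = +-mono-≤ (f≤g zero) (∑-mono-≤ (f≤g ∘ suc))

sum-tabulate : (f : Fin n → ℕ) → listSum (tabulate f) ≡ ∑[ i < n ] f i
sum-tabulate {zero}  f = refl
sum-tabulate {suc n} f = cong (f zero +_) (sum-tabulate (f ∘ suc))

sum-map-allFin : (f : Fin n → ℕ) → listSum (map f (allFin n)) ≡ ∑[ i < n ] f i
sum-map-allFin f = trans (cong listSum (map-tabulate (λ i → i) f)) (sum-tabulate f)

sum-concatMap : {A : Set} (f : A → List ℕ) (xs : List A) →
                listSum (concatMap f xs) ≡ listSum (map (listSum ∘ f) xs)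
sum-concatMap f List.[]         = refl
sum-concatMap f (x List.∷ xs) =
  trans (sum-++ (f x) (concatMap f xs)) (cong (listSum (f x) +_) (sum-concatMap f xs))

length-filter : {A : Set} (p : A → Bool) (xs : List A) →
                length (filter (λ y → T? (p y)) xs) ≡ listSum (map (λ y → [ p y ]· 1) xs)
length-filter p List.[] = refl
length-filter p (x List.∷ xs) with p x
... | true  = cong suc (length-filter p xs)
... | false = length-filter p xs

-- Sums over pairs x < y

<ᵇ-exclusive : ∀ {i j} k → i ≢ j → [ i <ᵇ j ]· k + [ j <ᵇ i ]· k ≡ k
<ᵇ-exclusive {i} {j} k i≢j
  with i <ᵇ j | <ᵇ-reflects-< i j | j <ᵇ i | <ᵇ-reflects-< j i
... | true  | ofʸ i<j | true  | ofʸ j<i = ⊥-elim (<-asym i<j j<i)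
... | true  | _       | false | _       = +-identityʳ k
... | false | _       | true  | _       = refl
... | false | ofⁿ i≮j | false | ofⁿ j≮i = ⊥-elim (i≢j (≤-antisym (≮⇒≥ j≮i) (≮⇒≥ i≮j)))

ordered : Fin n → Fin n → Bool
ordered x y = toℕ x <ᵇ toℕ y

pairSum : (Fin n → Fin n → ℕ) → ℕ
pairSum {n} f = ∑[ x < n ] ∑[ y < n ] [ ordered x y ]· f x y

pairSum-cong : {f g : Fin n → Fin n → ℕ} → (∀ x y → f x y ≡ g x y) → pairSum f ≡ pairSum g
pairSum-cong f≡g = sum-cong-≗ λ x → sum-cong-≗ λ y → cong ([ ordered x y ]·_) (f≡g x y)

pairSum-+ : (f g : Fin n → Fin n → ℕ) → pairSum (λ x y → f x y + g x y) ≡ pairSum f + pairSum g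
pairSum-+ {n} f g = begin
  pairSum (λ x y → f x y + g x y)
    ≡⟨ sum-cong-≗ (λ x → trans (sum-cong-≗ λ y → []·-+ (ordered x y) (f x y) (g x y))
                               (∑-distrib-+ (λ y → [ ordered x y ]· f x y) (λ y → [ ordered x y ]· g x y))) ⟩
  ∑[ x < n ] (∑[ y < n ] [ ordered x y ]· f x y + ∑[ y < n ] [ ordered x y ]· g x y)
    ≡⟨ ∑-distrib-+ (λ x → ∑[ y < n ] [ ordered x y ]· f x y) (λ x → ∑[ y < n ] [ ordered x y ]· g x y) ⟩
  pairSum f + pairSum g ∎
  where open ≡-Reasoning

pairSum-point : (a b : Fin n) (f : Fin n → Fin n → ℕ) →
                pairSum (λ x y → [ ⌊ a ≟ x ⌋ ∧ ⌊ b ≟ y ⌋ ]· f x y) ≡ [ ordered a b ]· f a b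
pairSum-point a b f =
  trans (sum-cong-≗ λ x → sum-cong-≗ λ y → []·-comm (ordered x y) (⌊ a ≟ x ⌋ ∧ ⌊ b ≟ y ⌋) (f x y))
        (∑∑-point a b (λ x y → [ ordered x y ]· f x y))

⌊≟⌋-sym : (a b : Fin n) → ⌊ a ≟ b ⌋ ≡ ⌊ b ≟ a ⌋
⌊≟⌋-sym a b with a ≟ b | b ≟ a
... | yes _    | yes _    = refl
... | no _     | no _     = refl
... | yes refl | no b≢a   = ⊥-elim (b≢a refl)
... | no a≢b   | yes refl = ⊥-elim (a≢b refl)

⌊≟⌋-injective : {l : Fin s → Fin n} → Injective _≡_ _≡_ l → ∀ i j → ⌊ l i ≟ l j ⌋ ≡ ⌊ i ≟ j ⌋
⌊≟⌋-injective {l = l} l-inj i j with l i ≟ l j | i ≟ j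
... | yes _  | yes _    = refl
... | no _   | no _     = refl
... | yes e  | no i≢j   = ⊥-elim (i≢j (l-inj e))
... | no ne  | yes refl = ⊥-elim (ne refl)

samePair-sym : (a b x y : Fin n) → samePair a b x y ≡ samePair a b y x
samePair-sym a b x y = ∨-comm (⌊ a ≟ x ⌋ ∧ ⌊ b ≟ y ⌋) (⌊ a ≟ y ⌋ ∧ ⌊ b ≟ x ⌋)

samePair-exclusive : {a b x y : Fin n} → a ≢ b →
                     (⌊ a ≟ x ⌋ ∧ ⌊ b ≟ y ⌋) ∧ (⌊ a ≟ y ⌋ ∧ ⌊ b ≟ x ⌋) ≡ false
samePair-exclusive {a = a} {b} {x} {y} a≢b with a ≟ x | b ≟ x
... | yes refl | yes refl = ⊥-elim (a≢b refl)
... | yes _    | no _     = trans (cong (⌊ b ≟ y ⌋ ∧_) (∧-zeroʳ ⌊ a ≟ y ⌋)) (∧-zeroʳ ⌊ b ≟ y ⌋)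
... | no _     | _        = refl

samePair-≢ : {a b x y : Fin n} → b ≢ x → b ≢ y → samePair a b x y ≡ false
samePair-≢ {a = a} {b} {x} {y} b≢x b≢y with b ≟ x | b ≟ y
... | yes b≡x | _       = ⊥-elim (b≢x b≡x)
... | no _    | yes b≡y = ⊥-elim (b≢y b≡y)
... | no _    | no _    = cong₂ _∨_ (∧-zeroʳ ⌊ a ≟ x ⌋) (∧-zeroʳ ⌊ a ≟ y ⌋)

samePair-≢ˡ : {a b x y : Fin n} → a ≢ x → samePair a b x y ≡ ⌊ x ≟ b ⌋ ∧ ⌊ a ≟ y ⌋
samePair-≢ˡ {a = a} {b} {x} {y} a≢x with a ≟ x
... | yes a≡x = ⊥-elim (a≢x a≡x)
... | no _    = trans (∧-comm ⌊ a ≟ y ⌋ ⌊ b ≟ x ⌋) (cong (_∧ ⌊ a ≟ y ⌋) (⌊≟⌋-sym b x))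

pairSum-samePair : {a b : Fin n} (c : Fin n → Fin n → ℕ) → a ≢ b → (∀ x y → c x y ≡ c y x) →
                   pairSum (λ x y → [ samePair a b x y ]· c x y) ≡ c a b
pairSum-samePair {a = a} {b} c a≢b c-sym = begin
  pairSum (λ x y → [ samePair a b x y ]· c x y)
    ≡⟨ pairSum-cong (λ x y → trans ([]·-∨ (⌊ a ≟ x ⌋ ∧ ⌊ b ≟ y ⌋) (⌊ a ≟ y ⌋ ∧ ⌊ b ≟ x ⌋) (c x y)
                                          (samePair-exclusive {x = x} {y} a≢b))
                                    (cong (λ t → [ ⌊ a ≟ x ⌋ ∧ ⌊ b ≟ y ⌋ ]· c x y + [ t ]· c x y)
                                          (∧-comm ⌊ a ≟ y ⌋ ⌊ b ≟ x ⌋))) ⟩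
  pairSum (λ x y → [ ⌊ a ≟ x ⌋ ∧ ⌊ b ≟ y ⌋ ]· c x y + [ ⌊ b ≟ x ⌋ ∧ ⌊ a ≟ y ⌋ ]· c x y)
    ≡⟨ pairSum-+ (λ x y → [ ⌊ a ≟ x ⌋ ∧ ⌊ b ≟ y ⌋ ]· c x y) (λ x y → [ ⌊ b ≟ x ⌋ ∧ ⌊ a ≟ y ⌋ ]· c x y) ⟩
  pairSum (λ x y → [ ⌊ a ≟ x ⌋ ∧ ⌊ b ≟ y ⌋ ]· c x y) + pairSum (λ x y → [ ⌊ b ≟ x ⌋ ∧ ⌊ a ≟ y ⌋ ]· c x y)
    ≡⟨ cong₂ _+_ (pairSum-point a b c) (pairSum-point b a c) ⟩
  [ ordered a b ]· c a b + [ ordered b a ]· c b a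
    ≡⟨ cong (λ z → [ ordered a b ]· c a b + [ ordered b a ]· z) (c-sym b a) ⟩
  [ ordered a b ]· c a b + [ ordered b a ]· c a b
    ≡⟨ <ᵇ-exclusive (c a b) (a≢b ∘ toℕ-injective) ⟩
  c a b ∎
  where open ≡-Reasoning

matchingSum : (a b : Fin s → Fin n) (e : Fin n → Fin n → ℕ) → Fin n → Fin n → ℕ
matchingSum {s} a b e x y = ∑[ k < s ] [ samePair (a k) (b k) x y ]· e x y

matchingSum-sym : (a b : Fin s → Fin n) {e : Fin n → Fin n → ℕ} → (∀ x y → e x y ≡ e y x) →
                  ∀ x y → matchingSum a b e x y ≡ matchingSum a b e y x
matchingSum-sym a b e-sym x y =
  sum-cong-≗ λ k → cong₂ [_]·_ (samePair-sym (a k) (b k) x y) (e-sym x y)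

pairSum-matching : (a b : Fin s → Fin n) (e : Fin n → Fin n → ℕ) → (∀ k → a k ≢ b k) →
                   (∀ x y → e x y ≡ e y x) → pairSum (matchingSum a b e) ≡ ∑[ k < s ] e (a k) (b k)
pairSum-matching {s} {n} a b e a≢b e-sym = begin
  pairSum (matchingSum a b e)
    ≡⟨ sum-cong-≗ (λ x → trans (sum-cong-≗ λ y → []·-∑ (ordered x y) (λ k → [ samePair (a k) (b k) x y ]· e x y))
                               (∑-comm (λ y k → [ ordered x y ]· [ samePair (a k) (b k) x y ]· e x y))) ⟩
  ∑[ x < n ] ∑[ k < s ] ∑[ y < n ] [ ordered x y ]· [ samePair (a k) (b k) x y ]· e x y
    ≡⟨ ∑-comm (λ x k → ∑[ y < n ] [ ordered x y ]· [ samePair (a k) (b k) x y ]· e x y) ⟩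
  ∑[ k < s ] pairSum (λ x y → [ samePair (a k) (b k) x y ]· e x y)
    ≡⟨ sum-cong-≗ (λ k → pairSum-samePair e (a≢b k) e-sym) ⟩
  ∑[ k < s ] e (a k) (b k) ∎
  where open ≡-Reasoning

edgeColour : {m : ℕ} → Coloring m → (Fin n → Fin m) → Fin n → Fin n → ℕ
edgeColour χ φ x y = toℕ (χ (φ x) (φ y))

edgeColour-sym : {m : ℕ} {χ : Coloring m} → SymColoring χ → (φ : Fin n → Fin m) →
                 ∀ x y → edgeColour χ φ x y ≡ edgeColour χ φ y x
edgeColour-sym χ-sym φ x y = cong toℕ (χ-sym (φ x) (φ y))

copyColorSum≡pairSum : {m : ℕ} (A : Fin n → Fin n → Bool) (χ : Coloring m) (φ : Fin n → Fin m) →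
                       copyColorSum A χ φ ≡ pairSum (λ x y → [ A x y ]· edgeColour χ φ x y)
copyColorSum≡pairSum {n} A χ φ = begin
  copyColorSum A χ φ
    ≡⟨ sum-concatMap (λ x → map (entry x) (allFin n)) (allFin n) ⟩
  listSum (map (λ x → listSum (map (entry x) (allFin n))) (allFin n))
    ≡⟨ sum-map-allFin (λ x → listSum (map (entry x) (allFin n))) ⟩
  ∑[ x < n ] listSum (map (entry x) (allFin n))
    ≡⟨ sum-cong-≗ (λ x → sum-map-allFin (entry x)) ⟩
  ∑[ x < n ] ∑[ y < n ] entry x y
    ≡⟨ sum-cong-≗ (λ x → sum-cong-≗ λ y → reorder x y) ⟩
  pairSum (λ x y → [ A x y ]· edgeColour χ φ x y) ∎
  where
  open ≡-Reasoning
  entry : Fin n → Fin n → ℕ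
  entry x y = [ A x y ∧ ordered x y ]· edgeColour χ φ x y
  reorder : ∀ x y → entry x y ≡ [ ordered x y ]· [ A x y ]· edgeColour χ φ x y
  reorder x y = trans (cong ([_]· edgeColour χ φ x y) (∧-comm (A x y) (ordered x y)))
                      ([]·-∧ (ordered x y) (A x y) (edgeColour χ φ x y))

-- Leaves and their relabelling

degree≡∑ : (G : Graph n) (x : Fin n) → degree G x ≡ ∑[ y < n ] [ Adj G x y ]· 1
degree≡∑ {n} G x = trans (length-filter (Adj G x) (allFin n)) (sum-map-allFin (λ y → [ Adj G x y ]· 1))

two-neighbours : (G : Graph n) {x u y : Fin n} → Adj G x u ≡ true → Adj G x y ≡ true → u ≢ y →
                 2 ≤ degree G x
two-neighbours {n} G {x} {u} {y} xu xy u≢y = begin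
  2
    ≡⟨ cong₂ _+_ (∑-point u (λ _ → 1)) (∑-point y (λ _ → 1)) ⟨
  ∑[ z < n ] [ ⌊ u ≟ z ⌋ ]· 1 + ∑[ z < n ] [ ⌊ y ≟ z ⌋ ]· 1
    ≡⟨ ∑-distrib-+ (λ z → [ ⌊ u ≟ z ⌋ ]· 1) (λ z → [ ⌊ y ≟ z ⌋ ]· 1) ⟨
  ∑[ z < n ] ([ ⌊ u ≟ z ⌋ ]· 1 + [ ⌊ y ≟ z ⌋ ]· 1)
    ≤⟨ ∑-mono-≤ pointwise ⟩
  ∑[ z < n ] [ Adj G x z ]· 1
    ≡⟨ degree≡∑ G x ⟨
  degree G x ∎
  where
  open ≤-Reasoning
  pointwise : ∀ z → [ ⌊ u ≟ z ⌋ ]· 1 + [ ⌊ y ≟ z ⌋ ]· 1 ≤ [ Adj G x z ]· 1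
  pointwise z with u ≟ z | y ≟ z
  ... | yes refl | yes refl = ⊥-elim (u≢y refl)
  ... | yes refl | no _     = ≤-reflexive (cong ([_]· 1) (sym xu))
  ... | no _     | yes refl = ≤-reflexive (cong ([_]· 1) (sym xy))
  ... | no _     | no _     = z≤n

leaf-adj : (G : Graph n) {x u : Fin n} → IsLeaf G x → Adj G x u ≡ true → ∀ y → Adj G x y ≡ ⌊ u ≟ y ⌋
leaf-adj G {x} {u} leaf xu y with u ≟ y
... | yes refl = xu
... | no u≢y with Adj G x y in xy
...   | false = refl
...   | true  = ⊥-elim (1+n≰n (subst (2 ≤_) leaf (two-neighbours G xu xy u≢y)))

permuteLabels : (Fin s → Fin n) → Permutation′ s → Fin n → Fin n
permuteLabels l σ x with any? (λ i → l i ≟ x)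
... | yes (i , _) = l (σ ⟨$⟩ʳ i)
... | no _        = x

module _ {l : Fin s → Fin n} (l-inj : Injective _≡_ _≡_ l) (σ : Permutation′ s) where

  permuteLabels-image : ∀ i → permuteLabels l σ (l i) ≡ l (σ ⟨$⟩ʳ i)
  permuteLabels-image i with any? (λ j → l j ≟ l i)
  ... | yes (j , lj≡li) = cong (λ k → l (σ ⟨$⟩ʳ k)) (l-inj lj≡li)
  ... | no ∄j           = ⊥-elim (∄j (i , refl))

  permuteLabels-fixed : {x : Fin n} → (∀ i → l i ≢ x) → permuteLabels l σ x ≡ x
  permuteLabels-fixed {x} x∉l with any? (λ i → l i ≟ x)
  ... | yes (i , li≡x) = ⊥-elim (x∉l i li≡x)
  ... | no _           = refl

  permuteLabels-injective : Injective _≡_ _≡_ (permuteLabels l σ)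
  permuteLabels-injective {x} {y} eq with any? (λ i → l i ≟ x) | any? (λ j → l j ≟ y)
  ... | yes (i , refl) | yes (j , refl) = cong l (Injection.injective (↔⇒↣ σ) (l-inj eq))
  ... | yes (i , _)    | no ∄j          = ⊥-elim (∄j (σ ⟨$⟩ʳ i , eq))
  ... | no ∄i          | yes (j , _)    = ⊥-elim (∄i (σ ⟨$⟩ʳ j , sym eq))
  ... | no _           | no _           = eq

-- Erdős–Ginzburg–Ziv for ℤ₃

+-cong-%3 : ∀ {x x′ y y′} → x % 3 ≡ x′ % 3 → y % 3 ≡ y′ % 3 → (x + y) % 3 ≡ (x′ + y′) % 3
+-cong-%3 {x} {x′} {y} {y′} x≡x′ y≡y′ = begin
  (x + y) % 3           ≡⟨ %-distribˡ-+ x y 3 ⟩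
  (x % 3 + y % 3) % 3   ≡⟨ cong₂ (λ p q → (p + q) % 3) x≡x′ y≡y′ ⟩
  (x′ % 3 + y′ % 3) % 3 ≡⟨ %-distribˡ-+ x′ y′ 3 ⟨
  (x′ + y′) % 3         ∎
  where open ≡-Reasoning

toℕ-mod-%3 : ∀ m → toℕ (m mod 3) % 3 ≡ m % 3
toℕ-mod-%3 m = trans (cong (_% 3) (toℕ-fromℕ< (m%n<n m 3))) (m%n%n≡m%n m 3)

tripleSum : (Fin 5 → ℕ) → Permutation′ 5 → ℕ
tripleSum g σ = g (σ ⟨$⟩ʳ 0F) + g (σ ⟨$⟩ʳ 1F) + g (σ ⟨$⟩ʳ 2F)

tripleSum-%3-cong : {g h : Fin 5 → ℕ} (σ : Permutation′ 5) → (∀ k → g k % 3 ≡ h k % 3) →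
                    tripleSum g σ % 3 ≡ tripleSum h σ % 3
tripleSum-%3-cong {g} {h} σ g≡h =
  +-cong-%3 {g a + g b} {h a + h b} {g c} {h c} (+-cong-%3 {g a} {h a} {g b} {h b} (g≡h a) (g≡h b)) (g≡h c)
  where
  a b c : Fin 5
  a = σ ⟨$⟩ʳ 0F
  b = σ ⟨$⟩ʳ 1F
  c = σ ⟨$⟩ʳ 2F

triple : Fin 5 → Fin 5 → Fin 5 → Permutation′ 5
triple i j k = transpose 2F k ∘ₚ transpose 1F j ∘ₚ transpose 0F i

-- Exhaustive search over the 3⁵ residue patterns; when i < j < k, triple i j k sends 0, 1, 2 to
-- i, j, k. Opaque, so that applying it to open terms does not unfold the search.
opaque
  residue-search : (a b c d e : Fin 3) →
                   ∃[ i ] ∃[ j ] ∃[ k ] tripleSum (toℕ ∘ (a ∷ b ∷ c ∷ d ∷ e ∷ [])) (triple i j k) % 3 ≡ 0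
  residue-search =
    from-yes (all? λ (a : Fin 3) → all? λ (b : Fin 3) → all? λ (c : Fin 3) → all? λ (d : Fin 3) →
              all? λ (e : Fin 3) → any? λ i → any? λ j → any? λ k →
              tripleSum (toℕ ∘ (a ∷ b ∷ c ∷ d ∷ e ∷ [])) (triple i j k) % 3 ℕ.≟ 0)

erdős-ginzburg-ziv₃ : (g : Fin 5 → ℕ) → ∃[ σ ] tripleSum g σ % 3 ≡ 0
erdős-ginzburg-ziv₃ g =
  let (i , j , k , zero-sum) = residue-search (r 0F) (r 1F) (r 2F) (r 3F) (r 4F)
  in triple i j k , trans (tripleSum-%3-cong {g = g} {h = toℕ ∘ rs} (triple i j k) residue) zero-sum
  where
  r rs : Fin 5 → Fin 3
  r k = g k mod 3
  rs = r 0F ∷ r 1F ∷ r 2F ∷ r 3F ∷ r 4F ∷ []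
  residue : ∀ x → g x % 3 ≡ toℕ (rs x) % 3
  residue 0F = sym (toℕ-mod-%3 (g 0F))
  residue 1F = sym (toℕ-mod-%3 (g 1F))
  residue 2F = sym (toℕ-mod-%3 (g 2F))
  residue 3F = sym (toℕ-mod-%3 (g 3F))
  residue 4F = sym (toℕ-mod-%3 (g 4F))

-- Replacing a₀, a₁, a₂ by b₀, b₁, b₂ changes a sum by Σ (bₖ + 2aₖ) modulo 3, as −a ≡ 2a.
%3-transfer : (S S′ : ℕ) (a b : Fin 5 → ℕ) →
              S + (b 0F + (b 1F + (b 2F + (a 3F + (a 4F + 0))))) ≡ S′ + ∑[ k < 5 ] a k →
              ((b 0F + 2 * a 0F) + (b 1F + 2 * a 1F) + (b 2F + 2 * a 2F)) % 3 ≡ 0 →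
              S % 3 ≡ 0 → S′ % 3 ≡ 0
%3-transfer S S′ a b balance D≡0 S≡0 = begin
  S′ % 3           ≡⟨ [m+kn]%n≡m%n S′ A 3 ⟨
  (S′ + A * 3) % 3 ≡⟨ cong (_% 3) (+-cancelʳ-≡ r (S′ + A * 3) (S + D) shifted) ⟩
  (S + D) % 3      ≡⟨ +-cong-%3 {S} {0} {D} {0} S≡0 D≡0 ⟩
  0                ∎
  where
  open ≡-Reasoning
  A D r : ℕ
  A = a 0F + a 1F + a 2F
  D = (b 0F + 2 * a 0F) + (b 1F + 2 * a 1F) + (b 2F + 2 * a 2F)
  r = a 3F + (a 4F + 0)
  regroupˡ : ∀ S′ a₀ a₁ a₂ r →
             S′ + (a₀ + a₁ + a₂) * 3 + r ≡ S′ + (a₀ + (a₁ + (a₂ + r))) + 2 * (a₀ + a₁ + a₂)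
  regroupˡ = solve-∀
  regroupʳ : ∀ S a₀ a₁ a₂ b₀ b₁ b₂ r → S + (b₀ + (b₁ + (b₂ + r))) + 2 * (a₀ + a₁ + a₂)
                                     ≡ S + ((b₀ + 2 * a₀) + (b₁ + 2 * a₁) + (b₂ + 2 * a₂)) + r
  regroupʳ = solve-∀
  shifted : S′ + A * 3 + r ≡ S + D + r
  shifted = begin
    S′ + A * 3 + r                           ≡⟨ regroupˡ S′ (a 0F) (a 1F) (a 2F) r ⟩
    S′ + ∑[ k < 5 ] a k + 2 * A              ≡⟨ cong (_+ 2 * A) balance ⟨
    S + (b 0F + (b 1F + (b 2F + r))) + 2 * A ≡⟨ regroupʳ S (a 0F) (a 1F) (a 2F) (b 0F) (b 1F) (b 2F) r ⟩
    S + D + r                                ∎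

-- Moving three leaves

moveAdj-sym : (G : Graph n) (u v l₁ l₂ l₃ x y : Fin n) →
              moveAdj G u v l₁ l₂ l₃ x y ≡ moveAdj G u v l₁ l₂ l₃ y x
moveAdj-sym G u v l₁ l₂ l₃ x y
  rewrite samePair-sym u l₁ x y | samePair-sym u l₂ x y | samePair-sym u l₃ x y
        | samePair-sym v l₁ x y | samePair-sym v l₂ x y | samePair-sym v l₃ x y
        | Adj-sym G x y = refl

-- The row of moveAdj at a leaf l i, once its samePair tests are evaluated; U and V stand for
-- y ≡ u and y ≡ v.
leafRow : Fin 5 → Bool → Bool → Bool
leafRow i U V = if (⌊ i ≟ 0F ⌋ ∧ U) ∨ (⌊ i ≟ 1F ⌋ ∧ U) ∨ (⌊ i ≟ 2F ⌋ ∧ U) then false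
                else if (⌊ i ≟ 0F ⌋ ∧ V) ∨ (⌊ i ≟ 1F ⌋ ∧ V) ∨ (⌊ i ≟ 2F ⌋ ∧ V) then true else U

leafRow-moved : ∀ U V → (U ≡ true → V ≡ false) →
                leafRow 0F U V ≡ V × leafRow 1F U V ≡ V × leafRow 2F U V ≡ V
leafRow-moved true  true  excl with excl refl
... | ()
leafRow-moved true  false _ = refl , refl , refl
leafRow-moved false true  _ = refl , refl , refl
leafRow-moved false false _ = refl , refl , refl

module MovedLeaves {n : ℕ} (F : Graph n) {u v : Fin n} {l : Fin 5 → Fin n}
                   (l-inj : Injective _≡_ _≡_ l) (u-l : ∀ i → Adj F u (l i) ≡ true)
                   (l-leaf : ∀ i → IsLeaf F (l i)) (v≢u : v ≢ u) (v≢l : ∀ i → v ≢ l i) where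

  F′ : Fin n → Fin n → Bool
  F′ = moveAdj F u v (l 0F) (l 1F) (l 2F)

  newCentre : Fin 5 → Fin n
  newCentre 0F = v
  newCentre 1F = v
  newCentre 2F = v
  newCentre 3F = u
  newCentre 4F = u

  Unlabelled : Fin n → Set
  Unlabelled x = ∀ i → l i ≢ x

  l≢u : Unlabelled u
  l≢u i li≡u with trans (sym (subst (λ x → Adj F u x ≡ true) li≡u (u-l i))) (loopless F u)
  ... | ()

  l≢v : Unlabelled v
  l≢v i = v≢l i ∘ sym

  l≢newCentre : ∀ k → Unlabelled (newCentre k)
  l≢newCentre 0F = l≢v
  l≢newCentre 1F = l≢v
  l≢newCentre 2F = l≢v
  l≢newCentre 3F = l≢u
  l≢newCentre 4F = l≢u

  Adj-l : ∀ i y → Adj F (l i) y ≡ ⌊ u ≟ y ⌋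
  Adj-l i = leaf-adj F (l-leaf i) (trans (Adj-sym F (l i) u) (u-l i))

  samePair-l : {a : Fin n} → Unlabelled a → ∀ k i y → samePair a (l k) (l i) y ≡ ⌊ i ≟ k ⌋ ∧ ⌊ a ≟ y ⌋
  samePair-l a∉l k i y =
    trans (samePair-≢ˡ (λ a≡li → a∉l i (sym a≡li))) (cong (_∧ _) (⌊≟⌋-injective l-inj i k))

  F′-leafRow : ∀ i y → F′ (l i) y ≡ leafRow i ⌊ u ≟ y ⌋ ⌊ v ≟ y ⌋
  F′-leafRow i y
    rewrite samePair-l l≢u 0F i y | samePair-l l≢u 1F i y | samePair-l l≢u 2F i y
          | samePair-l l≢v 0F i y | samePair-l l≢v 1F i y | samePair-l l≢v 2F i y
          | Adj-l i y = refl

  F′-l : ∀ i y → F′ (l i) y ≡ ⌊ newCentre i ≟ y ⌋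
  F′-l i y = trans (F′-leafRow i y) (centre i)
    where
    U V : Bool
    U = ⌊ u ≟ y ⌋
    V = ⌊ v ≟ y ⌋
    excl : U ≡ true → V ≡ false
    excl with u ≟ y | v ≟ y
    ... | yes refl | yes v≡u = ⊥-elim (v≢u v≡u)
    ... | yes _    | no _    = λ _ → refl
    ... | no _     | _       = λ ()
    moved : leafRow 0F U V ≡ V × leafRow 1F U V ≡ V × leafRow 2F U V ≡ V
    moved = leafRow-moved U V excl
    centre : ∀ i → leafRow i U V ≡ ⌊ newCentre i ≟ y ⌋
    centre 0F = proj₁ moved
    centre 1F = proj₁ (proj₂ moved)
    centre 2F = proj₂ (proj₂ moved)
    centre 3F = refl
    centre 4F = refl

  F′-unlabelled : {x y : Fin n} → Unlabelled x → Unlabelled y → F′ x y ≡ Adj F x y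
  F′-unlabelled x∉l y∉l
    rewrite samePair-≢ {a = u} (x∉l 0F) (y∉l 0F) | samePair-≢ {a = u} (x∉l 1F) (y∉l 1F)
          | samePair-≢ {a = u} (x∉l 2F) (y∉l 2F) | samePair-≢ {a = v} (x∉l 0F) (y∉l 0F)
          | samePair-≢ {a = v} (x∉l 1F) (y∉l 1F) | samePair-≢ {a = v} (x∉l 2F) (y∉l 2F) = refl

  matchingSum-l : {a : Fin 5 → Fin n} {e : Fin n → Fin n → ℕ} → (∀ k → Unlabelled (a k)) →
                  ∀ i y → matchingSum a l e (l i) y ≡ [ ⌊ a i ≟ y ⌋ ]· e (l i) y
  matchingSum-l {a} {e} a∉l i y =
    trans (sum-cong-≗ λ k → cong ([_]· e (l i) y) (samePair-l (a∉l k) k i y))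
          (∑-point-∧ i (λ k → ⌊ a k ≟ y ⌋) (e (l i) y))

  matchingSum-unlabelled : (a : Fin 5 → Fin n) (e : Fin n → Fin n → ℕ) {x y : Fin n} →
                           Unlabelled x → Unlabelled y → matchingSum a l e x y ≡ 0
  matchingSum-unlabelled a e {x} {y} x∉l y∉l =
    trans (sum-cong-≗ λ k → cong ([_]· e x y) (samePair-≢ {a = a k} (x∉l k) (y∉l k))) (sum-replicate-zero 5)

  module _ (c c′ : Fin n → Fin n → ℕ) (c-sym : ∀ x y → c x y ≡ c y x) (c′-sym : ∀ x y → c′ x y ≡ c′ y x)
           (c≡c′ : ∀ {x y} → Unlabelled x → Unlabelled y → c x y ≡ c′ x y) where

    -- Pointwise, E(F) + {newCentre k, l k}ₖ = E(F′) + {u, l k}ₖ as multisets of pairs, weighted by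
    -- the colourings c of a copy of F and c′ of a copy of F′ that only differ on the leaves.
    Exchange : Fin n → Fin n → Set
    Exchange x y = [ Adj F x y ]· c x y + matchingSum newCentre l c′ x y
                 ≡ [ F′ x y ]· c′ x y + matchingSum (λ _ → u) l c x y

    exchange-l : ∀ i y → Exchange (l i) y
    exchange-l i y = begin
      [ Adj F (l i) y ]· c (l i) y + matchingSum newCentre l c′ (l i) y
        ≡⟨ cong₂ _+_ (cong ([_]· c (l i) y) (Adj-l i y)) (matchingSum-l {e = c′} l≢newCentre i y) ⟩
      [ ⌊ u ≟ y ⌋ ]· c (l i) y + [ ⌊ newCentre i ≟ y ⌋ ]· c′ (l i) y
        ≡⟨ +-comm ([ ⌊ u ≟ y ⌋ ]· c (l i) y) _ ⟩
      [ ⌊ newCentre i ≟ y ⌋ ]· c′ (l i) y + [ ⌊ u ≟ y ⌋ ]· c (l i) y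
        ≡⟨ cong₂ _+_ (cong ([_]· c′ (l i) y) (F′-l i y)) (matchingSum-l {e = c} (λ _ → l≢u) i y) ⟨
      [ F′ (l i) y ]· c′ (l i) y + matchingSum (λ _ → u) l c (l i) y ∎
      where open ≡-Reasoning

    exchange-sym : ∀ {x y} → Exchange y x → Exchange x y
    exchange-sym {x} {y} e =
      trans (cong₂ _+_ (cong₂ [_]·_ (Adj-sym F x y) (c-sym x y)) (matchingSum-sym newCentre l c′-sym x y))
            (trans e (cong₂ _+_ (cong₂ [_]·_ (moveAdj-sym F u v (l 0F) (l 1F) (l 2F) y x) (c′-sym y x))
                                (matchingSum-sym (λ _ → u) l c-sym y x)))

    exchange-unlabelled : ∀ {x y} → Unlabelled x → Unlabelled y → Exchange x y
    exchange-unlabelled {x} {y} x∉l y∉l = begin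
      [ Adj F x y ]· c x y + matchingSum newCentre l c′ x y
        ≡⟨ cong ([ Adj F x y ]· c x y +_) (matchingSum-unlabelled newCentre c′ x∉l y∉l) ⟩
      [ Adj F x y ]· c x y + 0
        ≡⟨ cong₂ (λ b z → [ b ]· z + 0) (F′-unlabelled x∉l y∉l) (sym (c≡c′ x∉l y∉l)) ⟨
      [ F′ x y ]· c′ x y + 0
        ≡⟨ cong ([ F′ x y ]· c′ x y +_) (matchingSum-unlabelled (λ _ → u) c x∉l y∉l) ⟨
      [ F′ x y ]· c′ x y + matchingSum (λ _ → u) l c x y ∎
      where open ≡-Reasoning

    exchange : ∀ x y → Exchange x y
    exchange x y with any? (λ i → l i ≟ x) | any? (λ j → l j ≟ y)
    ... | yes (i , refl) | _              = exchange-l i y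
    ... | no _           | yes (j , refl) = exchange-sym (exchange-l j x)
    ... | no x∉l         | no y∉l         = exchange-unlabelled (λ i e → x∉l (i , e)) (λ j e → y∉l (j , e))

    exchange-pairSum : pairSum (λ x y → [ Adj F x y ]· c x y) + ∑[ k < 5 ] c′ (newCentre k) (l k)
                     ≡ pairSum (λ x y → [ F′ x y ]· c′ x y) + ∑[ k < 5 ] c u (l k)
    exchange-pairSum = begin
      pairSum (λ x y → [ Adj F x y ]· c x y) + ∑[ k < 5 ] c′ (newCentre k) (l k)
        ≡⟨ cong (_ +_) (pairSum-matching newCentre l c′ (λ k → l≢newCentre k k ∘ sym) c′-sym) ⟨
      pairSum (λ x y → [ Adj F x y ]· c x y) + pairSum (matchingSum newCentre l c′)
        ≡⟨ pairSum-+ (λ x y → [ Adj F x y ]· c x y) (matchingSum newCentre l c′) ⟨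
      pairSum (λ x y → [ Adj F x y ]· c x y + matchingSum newCentre l c′ x y)
        ≡⟨ pairSum-cong exchange ⟩
      pairSum (λ x y → [ F′ x y ]· c′ x y + matchingSum (λ _ → u) l c x y)
        ≡⟨ pairSum-+ (λ x y → [ F′ x y ]· c′ x y) (matchingSum (λ _ → u) l c) ⟩
      pairSum (λ x y → [ F′ x y ]· c′ x y) + pairSum (matchingSum (λ _ → u) l c)
        ≡⟨ cong (_ +_) (pairSum-matching (λ _ → u) l c (λ k → l≢u k ∘ sym) c-sym) ⟩
      pairSum (λ x y → [ F′ x y ]· c′ x y) + ∑[ k < 5 ] c u (l k) ∎
      where open ≡-Reasoning

  moved-copy : {m : ℕ} (χ : Coloring m) → SymColoring χ → (φ : Fin n → Fin m) (σ : Permutation′ 5) →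
               copyColorSum (Adj F) χ φ + ∑[ k < 5 ] edgeColour χ φ (newCentre k) (l (σ ⟨$⟩ʳ k))
               ≡ copyColorSum F′ χ (φ ∘ permuteLabels l σ) + ∑[ k < 5 ] edgeColour χ φ u (l (σ ⟨$⟩ʳ k))
  moved-copy χ χ-sym φ σ = begin
    copyColorSum (Adj F) χ φ + ∑[ k < 5 ] c (newCentre k) (l (σ ⟨$⟩ʳ k))
      ≡⟨ cong₂ _+_ (copyColorSum≡pairSum (Adj F) χ φ) (sum-cong-≗ relabel) ⟩
    pairSum (λ x y → [ Adj F x y ]· c x y) + ∑[ k < 5 ] c′ (newCentre k) (l k)
      ≡⟨ exchange-pairSum c c′ (edgeColour-sym χ-sym φ) (edgeColour-sym χ-sym (φ ∘ π)) agree ⟩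
    pairSum (λ x y → [ F′ x y ]· c′ x y) + ∑[ k < 5 ] c u (l k)
      ≡⟨ cong₂ _+_ (sym (copyColorSum≡pairSum F′ χ (φ ∘ π))) (∑-permute (λ k → c u (l k)) σ) ⟩
    copyColorSum F′ χ (φ ∘ π) + ∑[ k < 5 ] c u (l (σ ⟨$⟩ʳ k)) ∎
    where
    open ≡-Reasoning
    π : Fin n → Fin n
    π = permuteLabels l σ
    c c′ : Fin n → Fin n → ℕ
    c = edgeColour χ φ
    c′ = edgeColour χ (φ ∘ π)
    relabel : ∀ k → c (newCentre k) (l (σ ⟨$⟩ʳ k)) ≡ c′ (newCentre k) (l k)
    relabel k = sym (cong₂ (λ p q → toℕ (χ (φ p) (φ q)))
                           (permuteLabels-fixed l-inj σ (l≢newCentre k)) (permuteLabels-image l-inj σ k))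
    agree : ∀ {x y} → Unlabelled x → Unlabelled y → c x y ≡ c′ x y
    agree x∉l y∉l = sym (cong₂ (λ p q → toℕ (χ (φ p) (φ q)))
                               (permuteLabels-fixed l-inj σ x∉l) (permuteLabels-fixed l-inj σ y∉l))

lemma4p18 : (n m : ℕ) (F : Graph n) → IsForest F →
    (u v : Fin n) (l : Fin 5 → Fin n) → Injective _≡_ _≡_ l →
    (∀ i → Adj F u (l i) ≡ true) → (∀ i → IsLeaf F (l i)) →
    ¬ (v ≡ u) → (∀ i → ¬ (v ≡ l i)) →
    (χ : Coloring m) → SymColoring χ →
    HasZeroSumCopy (Adj F) χ →
    HasZeroSumCopy (moveAdj F u v (l zero) (l (suc zero)) (l (suc (suc zero)))) χ
lemma4p18 n m F _ u v l l-inj u-l l-leaf v≢u v≢l χ χ-sym (φ , φ-inj , zero-sum) =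
  ψ , ψ-inj ,
  %3-transfer (copyColorSum (Adj F) χ φ) (copyColorSum F′ χ ψ) (λ k → c u (l (σ ⟨$⟩ʳ k))) (λ k → c v (l (σ ⟨$⟩ʳ k)))
              (moved-copy χ χ-sym φ σ) σ-zero zero-sum
  where
  open MovedLeaves F l-inj u-l l-leaf v≢u v≢l
  c : Fin n → Fin n → ℕ
  c = edgeColour χ φ
  d : Fin 5 → ℕ
  d k = c v (l k) + 2 * c u (l k)
  σ : Permutation′ 5
  σ = proj₁ (erdős-ginzburg-ziv₃ d)
  σ-zero : tripleSum d σ % 3 ≡ 0
  σ-zero = proj₂ (erdős-ginzburg-ziv₃ d)
  ψ : Fin n → Fin m
  ψ = φ ∘ permuteLabels l σ
  ψ-inj : Injective _≡_ _≡_ ψ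
  ψ-inj = permuteLabels-injective l-inj σ ∘ φ-inj
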